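{- A permutation $\pi\in B_n$ is a $B$-arc permutation if and only if $$\pi = c_{n-1}^{k_{n-1}}c_{n-2}^{k_{n-2}}\cdots c_{1}^{k_{1}}c_0^{k_0},$$ with $0\le k_{n-1}\le 2n-1$ and $k_i\in\{0,2i+1\}$ for all $0\le i\le n-2$.
   Context: $B_n$ is the group of bijections $\pi$ of $\{\pm1,\dots,\pm n\}$ with $\pi(-a)=-\pi(a)$, written $\pi=[\pi(1),\dots,\pi(n)]$, with composition of functions as product ($(\sigma\tau)(x)=\sigma(\tau(x))$). Let $\mathcal{O}_n$ be a circle with $2n$ points labeled $-1,\dots,-n,1,\dots,n$ in clockwise order; an interval in $\mathcal{O}_n$ is a set of cyclically consecutive points. $\pi\in B_n$ is a $B$-arc permutation if for every $1\le j\le n$ the set $\{\pi(j),\dots,\pi(n)\}$ is an interval in $\mathcal{O}_n$. For $0\le m<n$, $c_m=\sigma_m\sigma_{m-1}\cdots\sigma_1\sigma_0=[-(m+1),1,2,\dots,m,m+2,\dots,n]$, where $\sigma_0=[-1,2,\dots,n]$ and $\sigma_i=(i,i+1)$ for $i\ge1$; $c_m$ has order $2m+2$. Every $\pi\in B_n$ has a unique expression $c_{n-1}^{k_{n-1}}\cdots c_0^{k_0}$ with $0\le k_i\le 2i+1$. -}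

module Defs where

open import Data.Bool using (Bool; true; false; not)
open import Data.Nat using (ℕ; zero; suc; _+_; _*_; _≤_; _<_)
open import Data.Nat.Properties using (_<?_; <-trans; n<1+n)
open import Data.Fin using (Fin; toℕ; fromℕ<)
open import Data.Fin.Permutation.Components using (transpose)
open import Data.Product using (Σ; ∃; _×_; _,_; proj₂)
open import Data.Sum using (_⊎_)
open import Function using (_∘_; id)
open import Function.Bundles using (_⇔_)
open import Function.Definitions using (Injective)
open import Relation.Binary.PropositionalEquality using (_≡_)
open import Relation.Nullary using (yes; no)

-- A signed point ±(a+1) of {±1,…,±n}: (true , a) is -(a+1), (false , a) is +(a+1)
-- (0-indexed absolute value a : Fin n).
SP : ℕ → Set
SP n = Bool × Fin n

-- Elements of B_n: π = [π(1),…,π(n)], i.e. the values on positive points,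
-- with |π(·)| a bijection of {1,…,n} (injective on Fin n).
record B (n : ℕ) : Set where
  field
    img    : Fin n → SP n
    absInj : Injective _≡_ _≡_ (proj₂ ∘ img)
open B public

-- extension of [π(1),…,π(n)] to all of {±1,…,±n} via π(-a) = -π(a)
ext : ∀ {n} → (Fin n → SP n) → SP n → SP n
ext f (s , a) with f a
... | (t , b) with s
...   | false = (t , b)
...   | true  = (not t , b)

-- generators as maps on signed points
-- σ_0 = [-1,2,…,n];  σ_i = (i,i+1) for 1 ≤ i < n
σ : ∀ {n} → ℕ → SP n → SP n
σ {n} zero (s , a) with toℕ a
... | zero  = (not s , a)
... | suc _ = (s , a)
σ {n} (suc j) (s , a) with suc j <? n
... | yes lt = (s , transpose (fromℕ< (<-trans (n<1+n j) lt)) (fromℕ< lt) a)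
... | no  _  = (s , a)

c : ∀ {n} → ℕ → SP n → SP n
c zero    = σ 0
c (suc m) = σ (suc m) ∘ c m

pow : ∀ {A : Set} → (A → A) → ℕ → A → A
pow f zero    = id
pow f (suc k) = f ∘ pow f k

prodC : ∀ {n} → (ℕ → ℕ) → ℕ → SP n → SP n
prodC k zero    = id
prodC k (suc m) = pow (c m) (k m) ∘ prodC k m

-- position on the circle O_n: -1,…,-n,1,…,n in clockwise order ↦ 0,…,2n-1
pos : ∀ {n} → SP n → ℕ
pos {n} (true  , a) = toℕ a
pos {n} (false , a) = n + toℕ a

-- a set P of positions (subset of {0,…,2n-1}) is an interval of O_n:
-- it is the set of cyclically consecutive points s, s+1, …, s+L-1 (mod 2n)
IsInterval : ℕ → (ℕ → Set) → Set
IsInterval n P =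
  Σ ℕ λ s → Σ ℕ λ L → s < 2 * n ×
    (∀ p → p < 2 * n →
      (P p ⇔ (Σ ℕ λ t → t < L × (s + t ≡ p ⊎ s + t ≡ p + 2 * n))))

IsBArc : ∀ {n} → B n → Set
IsBArc {n} π =
  (j : Fin n) → IsInterval n (λ p → Σ (Fin n) λ i → toℕ j ≤ toℕ i × pos (img π i) ≡ p)

module Submission where

open import Defs
open import Data.Bool using (Bool; true; false; not; if_then_else_)
open import Data.Nat
open import Data.Nat.Properties
open import Data.Nat.DivMod
open import Data.Nat.Tactic.RingSolver using (solve-∀)
open import Data.Fin using (Fin; toℕ; fromℕ<)
open import Data.Fin.Properties using (toℕ-fromℕ<; toℕ-injective; toℕ<n; fromℕ<-toℕ) renaming (_≟_ to _≟ᶠ_)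
open import Data.Fin.Permutation.Components using (transpose)
open import Data.Product using (Σ; _×_; _,_; proj₁; proj₂)
open import Data.Sum using (_⊎_; inj₁; inj₂; map; map₂)
open import Data.Empty using (⊥-elim)
open import Relation.Binary.PropositionalEquality using (_≡_; _≢_; refl; sym; trans; cong; cong₂; subst; subst₂; module ≡-Reasoning)
open import Relation.Nullary using (yes; no; ¬_; does)
open import Relation.Nullary.Decidable using (dec-true; dec-false)
open import Function using (_∘_)
open import Function.Bundles using (_⇔_; mk⇔; Equivalence)
open import Function.Construct.Composition using (_⇔-∘_)
open import Function.Construct.Identity using (⇔-id)
open import Function.Construct.Symmetry using (⇔-sym)
open import Data.Sum.Function.Propositional using (_⊎-⇔_)

-- Number the circle O_n by pos : -1,…,-n,1,…,n ↦ 0,…,2n-1.  On the 2i+2 points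
-- ±1,…,±(i+1) the element c_i is the rotation one step backwards (c-rotates), so c_i^{2i+1}
-- is the rotation one step forwards and c_m rotates all of O_n.  Hence for exponents
-- k_i ∈ {0, 2i+1} (recorded by bits e_i) the product ρ = c_{m-1}^{k_{m-1}}⋯c_0^{k_0} is
-- explicit (prodC-value): its positions g(a) = pos ρ(a+1) obey a placement rule -- g(j)
-- extends the arc occupied by g(j+1),…,g(m) at the end selected by e_j -- and by downward
-- induction every tail {g(j),…,g(m)} is an explicit arc of O_n (module Positions).
-- Backward direction: π = c_m^{k_m} ρ rotates these arcs, and rotated arcs are intervals.
-- Forward direction: rotate the positions of π so that π(n) sits at 2n-1; injectivity puts
-- g(j) outside the arc of j+1 and the interval property puts it next to that arc, so g obeys
-- the placement rule for e_j = [g(j) < n].  The rule determines the positions, so π = c_m^r ρ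
-- for the exponents read off from the bits e and the rotation r.

%-absorbˡ : ∀ a b d .{{_ : NonZero d}} → (a % d + b) % d ≡ (a + b) % d
%-absorbˡ a b d = begin
    (a % d + b) % d         ≡⟨ %-distribˡ-+ (a % d) b d ⟩
    (a % d % d + b % d) % d ≡⟨ cong (λ z → (z + b % d) % d) (m%n%n≡m%n a d) ⟩
    (a % d + b % d) % d     ≡⟨ sym (%-distribˡ-+ a b d) ⟩
    (a + b) % d             ∎
  where open ≡-Reasoning

succ-mod : ∀ M p → suc p < suc M → (p + 1) % suc M ≡ suc p
succ-mod M p lt = trans (m<n⇒m%n≡m (subst (_< suc M) (+-comm 1 p) lt)) (+-comm p 1)

-- The number 2i+1 = c_i's order minus one, in the additive shape the proofs use.
2i+1≡i+suc-i : ∀ i → 2 * i + 1 ≡ i + suc i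
2i+1≡i+suc-i = solve-∀

pow-simulate : ∀ {A : Set} (f : A → A) (e : A → ℕ) (g : ℕ → ℕ) (P : A → Set) →
  (∀ x → P x → P (f x) × e (f x) ≡ g (e x)) →
  ∀ k x → P x → P (pow f k x) × e (pow f k x) ≡ pow g k (e x)
pow-simulate f e g P step zero    x px = px , refl
pow-simulate f e g P step (suc k) x px with pow-simulate f e g P step k x px
... | py , ey with step (pow f k x) py
...   | pz , ez = pz , trans ez (cong g ey)

rotDown : ℕ → ℕ → ℕ
rotDown N zero    = N ∸ 1
rotDown N (suc p) = p

rotDown≡% : ∀ M p → p < suc M → rotDown (suc M) p ≡ (p + M) % suc M
rotDown≡% M zero    _  = sym (m≤n⇒m%n≡m ≤-refl)
rotDown≡% M (suc p) lt = begin
    p                   ≡⟨ sym (m<n⇒m%n≡m (<-trans (n<1+n p) lt)) ⟩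
    p % suc M           ≡⟨ sym ([m+n]%n≡m%n p (suc M)) ⟩
    (p + suc M) % suc M ≡⟨ cong (_% suc M) (+-suc p M) ⟩
    (suc p + M) % suc M ∎
  where open ≡-Reasoning

rotDown-iterate : ∀ M r p → p < suc M → pow (rotDown (suc M)) r p ≡ (p + r * M) % suc M
rotDown-iterate M zero p lt = trans (sym (m<n⇒m%n≡m lt)) (cong (_% suc M) (sym (+-identityʳ p)))
rotDown-iterate M (suc r) p lt = begin
    rotDown (suc M) (pow (rotDown (suc M)) r p)  ≡⟨ cong (rotDown (suc M)) (rotDown-iterate M r p lt) ⟩
    rotDown (suc M) ((p + r * M) % suc M)        ≡⟨ rotDown≡% M _ (m%n<n (p + r * M) (suc M)) ⟩
    ((p + r * M) % suc M + M) % suc M            ≡⟨ %-absorbˡ (p + r * M) M (suc M) ⟩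
    (p + r * M + M) % suc M                      ≡⟨ cong (_% suc M) (regroup p r M) ⟩
    (p + suc r * M) % suc M                      ∎
  where
  open ≡-Reasoning
  regroup : ∀ p r M → p + r * M + M ≡ p + suc r * M
  regroup = solve-∀

rotDown-undo : ∀ M p → p < suc M → pow (rotDown (suc M)) M p ≡ (p + 1) % suc M
rotDown-undo zero    zero    lt = refl
rotDown-undo zero    (suc p) (s≤s ())
rotDown-undo (suc K) p       lt = begin
    pow (rotDown (suc (suc K))) (suc K) p     ≡⟨ rotDown-iterate (suc K) (suc K) p lt ⟩
    (p + suc K * suc K) % suc (suc K)         ≡⟨ cong (_% suc (suc K)) (square K p) ⟩
    (p + 1 + K * suc (suc K)) % suc (suc K)   ≡⟨ [m+kn]%n≡m%n (p + 1) K (suc (suc K)) ⟩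
    (p + 1) % suc (suc K)                     ∎
  where
  open ≡-Reasoning
  square : ∀ K p → p + suc K * suc K ≡ p + 1 + K * suc (suc K)
  square = solve-∀

transpose-first : ∀ {n} (i j k : Fin n) → toℕ k ≡ toℕ i → transpose i j k ≡ j
transpose-first i j k k≡i with k ≟ᶠ i
... | yes _   = refl
... | no k≢i  = ⊥-elim (k≢i (toℕ-injective k≡i))

transpose-second : ∀ {n} (i j k : Fin n) → toℕ k ≢ toℕ i → toℕ k ≡ toℕ j → transpose i j k ≡ i
transpose-second i j k k≢i k≡j with k ≟ᶠ i
... | yes k≡i = ⊥-elim (k≢i (cong toℕ k≡i))
... | no _ with k ≟ᶠ j
...   | yes _    = refl
...   | no k≢j   = ⊥-elim (k≢j (toℕ-injective k≡j))

transpose-other : ∀ {n} (i j k : Fin n) → toℕ k ≢ toℕ i → toℕ k ≢ toℕ j → transpose i j k ≡ k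
transpose-other i j k k≢i k≢j with k ≟ᶠ i
... | yes k≡i = ⊥-elim (k≢i (cong toℕ k≡i))
... | no _ with k ≟ᶠ j
...   | yes k≡j = ⊥-elim (k≢j (cong toℕ k≡j))
...   | no _    = refl

σ-swap : ∀ {n} j (lt : suc j < n) s (a : Fin n) →
  σ (suc j) (s , a) ≡ (s , transpose (fromℕ< (<-trans (n<1+n j) lt)) (fromℕ< lt) a)
σ-swap {n} j lt s a with suc j <? n
... | yes _ = refl
... | no ¬lt = ⊥-elim (¬lt lt)

σ-away : ∀ {n} j s (a : Fin n) → toℕ a ≢ j → toℕ a ≢ suc j → σ (suc j) (s , a) ≡ (s , a)
σ-away {n} j s a a≢j a≢1+j with suc j <? n
... | yes lt = cong (s ,_) (transpose-other _ _ a (λ e → a≢j (trans e (toℕ-fromℕ< _)))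
                                                   (λ e → a≢1+j (trans e (toℕ-fromℕ< lt))))
... | no _   = refl

σ₀-flip : ∀ {n} s (a : Fin n) → toℕ a ≡ 0 → σ 0 (s , a) ≡ (not s , a)
σ₀-flip s a a≡0 with toℕ a
σ₀-flip s a refl | zero = refl

σ₀-fix : ∀ {n} s (a : Fin n) → 0 < toℕ a → σ 0 (s , a) ≡ (s , a)
σ₀-fix s a pos with toℕ a
σ₀-fix s a () | zero
... | suc _ = refl

c-fixes : ∀ {n} m s (a : Fin n) → m < toℕ a → c m (s , a) ≡ (s , a)
c-fixes zero    s a lt = σ₀-fix s a lt
c-fixes (suc m) s a lt rewrite c-fixes m s a (<-trans (n<1+n m) lt) =
  σ-away m s a (λ e → <-irrefl (sym e) (<-trans (n<1+n m) lt)) (λ e → <-irrefl (sym e) lt)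

c-at-one : ∀ {n} m s (a : Fin n) → m < n → toℕ a ≡ 0 →
  Σ (Fin n) λ b → toℕ b ≡ m × c m (s , a) ≡ (not s , b)
c-at-one zero    s a lt a≡0 = a , a≡0 , σ₀-flip s a a≡0
c-at-one (suc m) s a lt a≡0 with c-at-one m s a (<-trans (n<1+n m) lt) a≡0
... | b , b≡m , eq rewrite eq | σ-swap m lt (not s) b =
  _ , trans (cong toℕ (transpose-first _ _ b (trans b≡m (sym (toℕ-fromℕ< _))))) (toℕ-fromℕ< lt) , refl

c-lowers : ∀ {n} m s (a : Fin n) v → toℕ a ≡ suc v → v < m →
  Σ (Fin n) λ b → toℕ b ≡ v × c m (s , a) ≡ (s , b)
c-lowers zero s a v a≡1+v ()
c-lowers (suc m) s a v a≡1+v lt with v ≟ m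
... | yes refl rewrite c-fixes v s a (subst (v <_) (sym a≡1+v) (n<1+n v))
                     | σ-swap v (subst (_< _) a≡1+v (toℕ<n a)) s a =
  _ , trans (cong toℕ (transpose-second _ _ a a≢v (trans a≡1+v (sym (toℕ-fromℕ< _))))) (toℕ-fromℕ< _) , refl
  where
  a≢v : toℕ a ≢ toℕ (fromℕ< _)
  a≢v e = 1+n≢n (trans (sym a≡1+v) (trans e (toℕ-fromℕ< _)))
... | no v≢m with c-lowers m s a v a≡1+v (≤∧≢⇒< (s≤s⁻¹ lt) v≢m)
...   | b , b≡v , eq rewrite eq =
  b , b≡v , σ-away m s b (λ e → v≢m (trans (sym b≡v) e))
                         (λ e → <-irrefl (trans (sym b≡v) e) (<-trans (≤∧≢⇒< (s≤s⁻¹ lt) v≢m) (n<1+n m)))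

-- The 2i+2 points ±1,…,±(i+1) are those with |x| ≤ i (0-indexed); arcPos i
-- numbers them in the clockwise order -1,…,-(i+1),1,…,i+1 of the circle.
Within : ∀ {n} → ℕ → SP n → Set
Within i x = toℕ (proj₂ x) ≤ i

arcPos : ∀ {n} → ℕ → SP n → ℕ
arcPos i (true  , a) = toℕ a
arcPos i (false , a) = suc i + toℕ a

arcPos< : ∀ {n} i (x : SP n) → Within i x → arcPos i x < suc i + suc i
arcPos< i (true  , a) le = s≤s (≤-trans le (m≤m+n i (suc i)))
arcPos< i (false , a) le = +-monoʳ-< (suc i) (s≤s le)

c-rotates : ∀ {n} i (x : SP n) → i < n → Within i x →
  Within i (c i x) × arcPos i (c i x) ≡ rotDown (suc i + suc i) (arcPos i x)
c-rotates i (s , a) lt le = go s (toℕ a) refl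
  where
  go : ∀ s v → toℕ a ≡ v →
    Within i (c i (s , a)) × arcPos i (c i (s , a)) ≡ rotDown (suc i + suc i) (arcPos i (s , a))
  go s zero a≡0 with c-at-one i s a lt a≡0
  go true  zero a≡0 | b , b≡i , eq rewrite eq | a≡0 | b≡i = ≤-refl , sym (+-suc i i)
  go false zero a≡0 | b , b≡i , eq rewrite eq | a≡0 | b≡i = ≤-refl , sym (+-identityʳ i)
  go s (suc v) a≡1+v with subst (_≤ i) a≡1+v le
  ... | 1+v≤i with c-lowers i s a v a≡1+v 1+v≤i
  go true  (suc v) a≡1+v | 1+v≤i | b , b≡v , eq rewrite eq | a≡1+v | b≡v = ≤-trans (n≤1+n v) 1+v≤i , refl
  go false (suc v) a≡1+v | 1+v≤i | b , b≡v , eq rewrite eq | a≡1+v | b≡v = ≤-trans (n≤1+n v) 1+v≤i , sym (+-suc i v)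

c-power-rotates : ∀ {n} i r (x : SP n) → i < n → Within i x →
  Within i (pow (c i) r x) × arcPos i (pow (c i) r x) ≡ (arcPos i x + r * (i + suc i)) % (suc i + suc i)
c-power-rotates i r x lt le with pow-simulate (c i) (arcPos i) (rotDown (suc i + suc i)) (Within i)
                                   (λ y → c-rotates i y lt) r x le
... | le' , eq = le' , trans eq (rotDown-iterate (i + suc i) r (arcPos i x) (arcPos< i x le))

c-inverse-rotates : ∀ {n} i (x : SP n) → i < n → Within i x →
  Within i (pow (c i) (2 * i + 1) x) × arcPos i (pow (c i) (2 * i + 1) x) ≡ (arcPos i x + 1) % (suc i + suc i)
c-inverse-rotates i x lt le rewrite 2i+1≡i+suc-i i
  with pow-simulate (c i) (arcPos i) (rotDown (suc i + suc i)) (Within i) (λ y → c-rotates i y lt) (i + suc i) x le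
... | le' , eq = le' , trans eq (rotDown-undo (i + suc i) (arcPos i x) (arcPos< i x le))

arcPos-neg : ∀ {n} i (y : SP n) v → Within i y → arcPos i y ≡ v → v ≤ i →
  Σ (Fin n) λ b → toℕ b ≡ v × y ≡ (true , b)
arcPos-neg i (true  , b) v le eq v≤i = b , eq , refl
arcPos-neg i (false , b) v le eq v≤i =
  ⊥-elim (<-irrefl refl (≤-trans (subst (suc i ≤_) eq (m≤m+n (suc i) _)) v≤i))

arcPos-pos : ∀ {n} i (y : SP n) w → Within i y → arcPos i y ≡ suc i + w →
  Σ (Fin n) λ b → toℕ b ≡ w × y ≡ (false , b)
arcPos-pos i (true  , b) w le eq = ⊥-elim (<-irrefl refl (≤-trans (subst (suc i ≤_) (sym eq) (m≤m+n (suc i) _)) le))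
arcPos-pos i (false , b) w le eq = b , +-cancelˡ-≡ (suc i) _ _ eq , refl

c-inverse-raises : ∀ {n} i s (b : Fin n) → i < n → toℕ b < i →
  Σ (Fin n) λ b' → toℕ b' ≡ suc (toℕ b) × pow (c i) (2 * i + 1) (s , b) ≡ (s , b')
c-inverse-raises i s b lt b<i with c-inverse-rotates i (s , b) lt (<⇒≤ b<i)
c-inverse-raises i true  b lt b<i | le , eq =
  arcPos-neg i _ _ le (trans eq (succ-mod (i + suc i) (toℕ b) (<-≤-trans (s≤s b<i) (s≤s (m≤m+n i _))))) b<i
c-inverse-raises i false b lt b<i | le , eq =
  arcPos-pos i _ _ le (trans eq (trans (succ-mod (i + suc i) (suc i + toℕ b) next<N) (sym (+-suc (suc i) (toℕ b)))))
  where
  next<N : suc (suc i + toℕ b) < suc i + suc i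
  next<N = subst (_< suc i + suc i) (+-suc (suc i) (toℕ b)) (+-monoʳ-< (suc i) (s≤s b<i))

c-inverse-wraps : ∀ {n} i (a : Fin n) → i < n → toℕ a ≡ i →
  Σ (Fin n) λ b → toℕ b ≡ 0 × pow (c i) (2 * i + 1) (false , a) ≡ (true , b)
c-inverse-wraps i a lt a≡i with c-inverse-rotates i (false , a) lt (≤-reflexive a≡i)
... | le , eq = arcPos-neg i _ 0 le (trans eq wraps) z≤n
  where
  wraps : (suc i + toℕ a + 1) % (suc i + suc i) ≡ 0
  wraps rewrite a≡i | +-assoc (suc i) i 1 | +-comm i 1 = n%n≡0 (suc i + suc i)

c-power-fixes : ∀ {n} i r s (a : Fin n) → i < toℕ a → pow (c i) r (s , a) ≡ (s , a)
c-power-fixes i zero    s a lt = refl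
c-power-fixes i (suc r) s a lt rewrite c-power-fixes i r s a lt = c-fixes i s a lt

prodC-fixes : ∀ {n} k i s (a : Fin n) → i ≤ toℕ a → prodC k i (s , a) ≡ (s , a)
prodC-fixes k zero    s a le = refl
prodC-fixes k (suc i) s a le rewrite prodC-fixes k i s a (≤-trans (n≤1+n i) le) = c-power-fixes i (k i) s a le

Pattern : (ℕ → ℕ) → (ℕ → Bool) → ℕ → Set
Pattern k e m = ∀ i → i < m → (e i ≡ false × k i ≡ 0) ⊎ (e i ≡ true × k i ≡ 2 * i + 1)

b2n : Bool → ℕ
b2n true  = 1
b2n false = 0

ones : (ℕ → Bool) → ℕ → ℕ → ℕ
ones e j zero    = 0
ones e j (suc d) = b2n (e j) + ones e (suc j) d

ones-step : ∀ e j d {t} → e (d + j) ≡ t → ones e j (suc d) ≡ ones e j d + b2n t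
ones-step e j zero    refl = +-identityʳ _
ones-step e j (suc d) eq   = begin
    b2n (e j) + ones e (suc j) (suc d)          ≡⟨ cong (b2n (e j) +_) (ones-step e (suc j) d (trans (cong e (+-suc d j)) eq)) ⟩
    b2n (e j) + (ones e (suc j) d + b2n _)      ≡⟨ sym (+-assoc (b2n (e j)) _ _) ⟩
    b2n (e j) + ones e (suc j) d + b2n _        ∎
  where open ≡-Reasoning

-- Where c_a^{k_a} sends +(a+1): to itself (|·| = a) if k_a = 0, to -1 (|·| = 0) otherwise.
start : Bool → ℕ → ℕ
start true  a = 0
start false a = a

-- Under a pattern, c_{i-1}^{k_{i-1}}⋯c_0^{k_0} sends +(a+1) (for a < i ≤ m)
-- to the point of sign e_a whose |·| is start e_a a raised once for each later
-- factor with k = 2i+1, i.e. by ones e (a+1) (i-a-1).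
prodC-value : ∀ {n} k e m → Pattern k e m → m ≤ n → (a : Fin n) → ∀ d → d + suc (toℕ a) ≤ m →
  Σ (Fin n) λ b → toℕ b ≡ start (e (toℕ a)) (toℕ a) + ones e (suc (toℕ a)) d × toℕ b < d + suc (toℕ a) ×
     prodC k (d + suc (toℕ a)) (false , a) ≡ (e (toℕ a) , b)
prodC-value k e m P m≤n a zero le rewrite prodC-fixes k (toℕ a) false a ≤-refl with P (toℕ a) le
... | inj₁ (e≡f , k≡0) rewrite e≡f | k≡0 = a , sym (+-identityʳ _) , ≤-refl , refl
... | inj₂ (e≡t , k≡1) rewrite e≡t | k≡1 with c-inverse-wraps (toℕ a) a (toℕ<n a) refl
...   | b , b≡0 , eq = b , b≡0 , subst (_< suc (toℕ a)) (sym b≡0) (s≤s z≤n) , eq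
prodC-value k e m P m≤n a (suc d) le with prodC-value k e m P m≤n a d (≤-trans (n≤1+n _) le)
... | b , b≡ , b< , eq rewrite eq with P (d + suc (toℕ a)) le
...   | inj₁ (e≡f , k≡0) rewrite k≡0 =
  b , trans b≡ (cong (S +_) (trans (sym (+-identityʳ _)) (sym (ones-step e (suc (toℕ a)) d e≡f)))) ,
  <-trans b< (n<1+n _) , refl
  where
  S : ℕ
  S = start (e (toℕ a)) (toℕ a)
...   | inj₂ (e≡t , k≡1) rewrite k≡1 with c-inverse-raises (d + suc (toℕ a)) (e (toℕ a)) b (≤-trans le m≤n) b<
...     | b' , b'≡ , eq' = b' , trans b'≡ raised , subst (_< suc (d + suc (toℕ a))) (sym b'≡) (s≤s b<) , eq'
  where
  S : ℕ
  S = start (e (toℕ a)) (toℕ a)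
  O : ℕ
  O = ones e (suc (toℕ a)) d
  raised : suc (toℕ b) ≡ S + ones e (suc (toℕ a)) (suc d)
  raised = begin
    suc (toℕ b)  ≡⟨ cong suc b≡ ⟩
    suc (S + O)  ≡⟨ sym (+-suc S O) ⟩
    S + suc O    ≡⟨ cong (S +_) (trans (+-comm 1 O) (sym (ones-step e (suc (toℕ a)) d e≡t))) ⟩
    S + ones e (suc (toℕ a)) (suc d) ∎
    where open ≡-Reasoning

downward-induction : ∀ (P : ℕ → Set) m → P m → (∀ j → j < m → P (suc j) → P j) → ∀ j → j ≤ m → P j
downward-induction P m Pm step j j≤m = go (m ∸ j) j (m∸n+n≡m j≤m)
  where
  go : ∀ d j → d + j ≡ m → P j
  go zero    j refl = Pm
  go (suc d) j eq   = step j (subst (j <_) eq (s≤s (m≤n+m j d))) (go d (suc j) (trans (+-suc d j) eq))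

m∸j≡suc : ∀ m j → j < m → m ∸ j ≡ suc (m ∸ suc j)
m∸j≡suc (suc m) zero    _         = refl
m∸j≡suc (suc m) (suc j) (s≤s j<m) = m∸j≡suc m j j<m

zeros : (ℕ → Bool) → ℕ → ℕ → ℕ
zeros e j zero    = 0
zeros e j (suc d) = b2n (not (e j)) + zeros e (suc j) d

ones+zeros : ∀ e j d → ones e j d + zeros e j d ≡ d
ones+zeros e j zero = refl
ones+zeros e j (suc d) with e j
... | true  = cong suc (ones+zeros e (suc j) d)
... | false = trans (+-suc _ _) (cong suc (ones+zeros e (suc j) d))

-- The arc of a circle of N points made of the Z+1 top positions N-1-Z,…,N-1 followed
-- (cyclically) by the M bottom positions 0,…,M-1.
Arc : ℕ → ℕ → ℕ → ℕ → Set
Arc N Z M q = N ≤ q + suc Z ⊎ q < M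

top : (m : ℕ) → Fin (suc m)
top m = fromℕ< (n<1+n m)

-- Fix bits e_0,…,e_{m-1} and positions g(0),…,g(m) ∈ [0, 2n) (n = m+1).
-- The arc of j is made of the zerosAbove j + 1 top positions 2n-1-zerosAbove j,…,2n-1 and
-- the onesAbove j bottom positions 0,…,onesAbove j - 1; the tail {g(j),…,g(m)} fills it
-- when the two sets coincide.  If g(m) = 2n-1 and each g(j) is placed next to the arc of
-- j+1 -- right after its bottom run when e_j holds, right before its top run otherwise --
-- then every tail fills its arc (Filling.fills-all).
module Positions (m : ℕ) (e : ℕ → Bool) where
  N : ℕ
  N = suc m + suc m

  onesAbove zerosAbove : ℕ → ℕ
  onesAbove  j = ones  e j (m ∸ j)
  zerosAbove j = zeros e j (m ∸ j)

  InArc : ℕ → ℕ → Set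
  InArc j = Arc N (zerosAbove j) (onesAbove j)

  Placed : Bool → ℕ → ℕ → Set
  Placed true  x j = x ≡ onesAbove (suc j)
  Placed false x j = x + suc (suc (zerosAbove (suc j))) ≡ N

  placed-unique : ∀ b {x x'} j → Placed b x j → Placed b x' j → x ≡ x'
  placed-unique true  j p p' = trans p (sym p')
  placed-unique false j p p' = +-cancelʳ-≡ _ _ _ (trans p (sym p'))

  onesAbove-step : ∀ j → j < m → onesAbove j ≡ b2n (e j) + onesAbove (suc j)
  onesAbove-step j lt rewrite m∸j≡suc m j lt = refl

  zerosAbove-step : ∀ j → j < m → zerosAbove j ≡ b2n (not (e j)) + zerosAbove (suc j)
  zerosAbove-step j lt rewrite m∸j≡suc m j lt = refl

  arc-size : ∀ j → onesAbove j + zerosAbove j ≡ m ∸ j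
  arc-size j = ones+zeros e j (m ∸ j)

  index : ∀ j → j < m → Fin (suc m)
  index j lt = fromℕ< (s≤s (<⇒≤ lt))

  module Filling (g : Fin (suc m) → ℕ) where
    Attained : ℕ → ℕ → Set
    Attained j q = Σ (Fin (suc m)) λ i → j ≤ toℕ i × g i ≡ q

    FillsArc : ℕ → Set
    FillsArc j = ∀ q → q < N → Attained j q ⇔ InArc j q

    fills-top : suc (g (top m)) ≡ N → FillsArc m
    fills-top g-top q q<N rewrite n∸n≡0 m = mk⇔ to from
      where
      top-only : ∀ i → m ≤ toℕ i → i ≡ top m
      top-only i le = toℕ-injective (trans (≤-antisym (s≤s⁻¹ (toℕ<n i)) le) (sym (toℕ-fromℕ< (n<1+n m))))
      to : Attained m q → N ≤ q + 1 ⊎ q < 0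
      to (i , le , gi) rewrite top-only i le = inj₁ (≤-reflexive (trans (sym g-top) (trans (cong suc gi) (+-comm 1 q))))
      from : N ≤ q + 1 ⊎ q < 0 → Attained m q
      from (inj₁ le) = top m , ≤-reflexive (sym (toℕ-fromℕ< (n<1+n m))) ,
                       suc-injective (trans g-top (≤-antisym (subst (N ≤_) (+-comm q 1) le) q<N))
      from (inj₂ ())

    attained-step : ∀ j (lt : j < m) q → Attained j q ⇔ (g (index j lt) ≡ q ⊎ Attained (suc j) q)
    attained-step j lt q = mk⇔ to from
      where
      to : Attained j q → g (index j lt) ≡ q ⊎ Attained (suc j) q
      to (i , le , gi) with toℕ i ≟ j
      ... | yes i≡j = inj₁ (subst (λ z → g z ≡ q) (toℕ-injective (trans i≡j (sym (toℕ-fromℕ< _)))) gi)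
      ... | no  i≢j = inj₂ (i , ≤∧≢⇒< le (i≢j ∘ sym) , gi)
      from : g (index j lt) ≡ q ⊎ Attained (suc j) q → Attained j q
      from (inj₁ gj) = index j lt , ≤-reflexive (sym (toℕ-fromℕ< _)) , gj
      from (inj₂ (i , le , gi)) = i , <⇒≤ le , gi

    inArc-step : ∀ j (lt : j < m) q → Placed (e j) (g (index j lt)) j →
      InArc j q ⇔ (g (index j lt) ≡ q ⊎ InArc (suc j) q)
    inArc-step j lt q placed rewrite onesAbove-step j lt | zerosAbove-step j lt with e j
    ... | true = mk⇔ to from
      where
      Z : ℕ
      Z = zerosAbove (suc j)
      to : N ≤ q + suc Z ⊎ q < suc (onesAbove (suc j)) → g (index j lt) ≡ q ⊎ InArc (suc j) q
      to (inj₁ x) = inj₂ (inj₁ x)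
      to (inj₂ y) with m≤n⇒m<n∨m≡n (s≤s⁻¹ y)
      ... | inj₁ y' = inj₂ (inj₂ y')
      ... | inj₂ y' = inj₁ (trans placed (sym y'))
      from : g (index j lt) ≡ q ⊎ InArc (suc j) q → N ≤ q + suc Z ⊎ q < suc (onesAbove (suc j))
      from (inj₁ x) = inj₂ (s≤s (≤-reflexive (trans (sym x) placed)))
      from (inj₂ (inj₁ x)) = inj₁ x
      from (inj₂ (inj₂ y)) = inj₂ (<-trans y (n<1+n _))
    ... | false = mk⇔ to from
      where
      Z : ℕ
      Z = zerosAbove (suc j)
      to : N ≤ q + suc (suc Z) ⊎ q < onesAbove (suc j) → g (index j lt) ≡ q ⊎ InArc (suc j) q
      to (inj₁ x) with m≤n⇒m<n∨m≡n x
      ... | inj₁ x' = inj₂ (inj₁ (s≤s⁻¹ (subst (suc N ≤_) (+-suc q _) x')))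
      ... | inj₂ x' = inj₁ (+-cancelʳ-≡ _ _ _ (trans placed x'))
      to (inj₂ y) = inj₂ (inj₂ y)
      from : g (index j lt) ≡ q ⊎ InArc (suc j) q → N ≤ q + suc (suc Z) ⊎ q < onesAbove (suc j)
      from (inj₁ x) = inj₁ (≤-reflexive (trans (sym placed) (cong (_+ _) x)))
      from (inj₂ (inj₁ x)) = inj₁ (subst (N ≤_) (sym (+-suc q (suc Z))) (≤-trans x (n≤1+n _)))
      from (inj₂ (inj₂ y)) = inj₂ y

    fills-step : ∀ j (lt : j < m) → FillsArc (suc j) → Placed (e j) (g (index j lt)) j → FillsArc j
    fills-step j lt fills placed q q<N =
      ⇔-sym (inArc-step j lt q placed) ⇔-∘ ((⇔-id _ ⊎-⇔ fills q q<N) ⇔-∘ attained-step j lt q)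

    fills-all : suc (g (top m)) ≡ N → (∀ j (lt : j < m) → FillsArc (suc j) → Placed (e j) (g (index j lt)) j) →
      ∀ j → j ≤ m → FillsArc j
    fills-all g-top placed = downward-induction FillsArc m (fills-top g-top)
                               (λ j lt fills → fills-step j lt fills (placed j lt fills))

arcPos≡pos : ∀ m (y : SP (suc m)) → arcPos m y ≡ pos y
arcPos≡pos m (true  , a) = refl
arcPos≡pos m (false , a) = refl

pos< : ∀ m (y : SP (suc m)) → pos y < suc m + suc m
pos< m y = subst (_< suc m + suc m) (arcPos≡pos m y) (arcPos< m y (s≤s⁻¹ (toℕ<n (proj₂ y))))

pos-injective : ∀ m (u v : SP (suc m)) → pos u ≡ pos v → u ≡ v
pos-injective m (true  , a) (true  , b) eq = cong (true ,_) (toℕ-injective eq)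
pos-injective m (true  , a) (false , b) eq =
  ⊥-elim (<-irrefl refl (<-≤-trans (toℕ<n a) (subst (suc m ≤_) (sym eq) (m≤m+n (suc m) (toℕ b)))))
pos-injective m (false , a) (true  , b) eq =
  ⊥-elim (<-irrefl refl (<-≤-trans (toℕ<n b) (subst (suc m ≤_) eq (m≤m+n (suc m) (toℕ a)))))
pos-injective m (false , a) (false , b) eq = cong (false ,_) (toℕ-injective (+-cancelˡ-≡ (suc m) _ _ eq))

pos-c-power : ∀ m r (y : SP (suc m)) → pos (pow (c m) r y) ≡ (pos y + r * (m + suc m)) % (suc m + suc m)
pos-c-power m r y = begin
    pos (pow (c m) r y)                               ≡⟨ sym (arcPos≡pos m (pow (c m) r y)) ⟩
    arcPos m (pow (c m) r y)                          ≡⟨ proj₂ (c-power-rotates m r y (n<1+n m) (s≤s⁻¹ (toℕ<n (proj₂ y)))) ⟩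
    (arcPos m y + r * (m + suc m)) % (suc m + suc m)  ≡⟨ cong (λ z → (z + r * (m + suc m)) % (suc m + suc m)) (arcPos≡pos m y) ⟩
    (pos y + r * (m + suc m)) % (suc m + suc m)       ∎
  where open ≡-Reasoning

-- A positive point +(n+j+M) (M ones among the Z+M indices after j) sits
-- just before a top run of Z+1 points.
placed-false-arith : ∀ m j M Z → suc j + (M + Z) ≡ m → suc m + (j + M) + suc (suc Z) ≡ suc m + suc m
placed-false-arith m j M Z refl = shape j M Z
  where
  shape : ∀ j M Z → suc (suc j + (M + Z)) + (j + M) + suc (suc Z) ≡ suc (suc j + (M + Z)) + suc (suc j + (M + Z))
  shape = solve-∀

-- The positions of ρ = c_{m-1}^{k_{m-1}}⋯c_0^{k_0} under a pattern: each g(a) is placed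
-- next to the arc of a+1 as prescribed by e_a, and g(m) = 2n-1; so every tail of
-- positions fills its arc.
module ProductPositions (m : ℕ) (k : ℕ → ℕ) (e : ℕ → Bool) (P : Pattern k e m) where
  ρ : SP (suc m) → SP (suc m)
  ρ = prodC k m

  g : Fin (suc m) → ℕ
  g a = pos (ρ (false , a))

  open Positions m e
  open Filling g

  placed-at : ∀ (a : Fin (suc m)) → toℕ a < m → Placed (e (toℕ a)) (g a) (toℕ a)
  placed-at a a<m with prodC-value k e m P (n≤1+n m) a (m ∸ suc (toℕ a)) (≤-reflexive (m∸n+n≡m a<m))
  ... | b , b≡ , _ , eq rewrite m∸n+n≡m a<m | eq with e (toℕ a)
  ...   | true  = b≡
  ...   | false rewrite b≡ =
    placed-false-arith m (toℕ a) _ _ (trans (cong (suc (toℕ a) +_) (arc-size (suc (toℕ a)))) (m+[n∸m]≡n a<m))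

  placed : ∀ j (lt : j < m) → Placed (e j) (g (index j lt)) j
  placed j lt = subst (λ z → Placed (e z) (g (index j lt)) z) (toℕ-fromℕ< _)
                      (placed-at (index j lt) (subst (_< m) (sym (toℕ-fromℕ< _)) lt))

  g-top : suc (g (top m)) ≡ N
  g-top rewrite prodC-fixes k m false (top m) (≤-reflexive (sym (toℕ-fromℕ< (n<1+n m))))
              | toℕ-fromℕ< (n<1+n m) = sym (+-suc (suc m) m)

  fills : ∀ j → j ≤ m → FillsArc j
  fills = fills-all g-top (λ j lt _ → placed j lt)

2*n≡n+n : ∀ n → 2 * n ≡ n + n
2*n≡n+n n = cong (n +_) (+-identityʳ n)

mod-split : ∀ K x p → x < suc K + suc K → x % suc K ≡ p → x ≡ p ⊎ x ≡ p + suc K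
mod-split K x p x<2N x%N≡p with x <? suc K
... | yes x<N = inj₁ (trans (sym (m<n⇒m%n≡m x<N)) x%N≡p)
... | no  x≮N = inj₂ (begin
    x                 ≡⟨ sym (m∸n+n≡m N≤x) ⟩
    x ∸ suc K + suc K ≡⟨ cong (_+ suc K) (sym (m<n⇒m%n≡m u<N)) ⟩
    u % suc K + suc K ≡⟨ cong (_+ suc K) (sym ([m+n]%n≡m%n u (suc K))) ⟩
    (u + suc K) % suc K + suc K ≡⟨ cong (λ z → z % suc K + suc K) (m∸n+n≡m N≤x) ⟩
    x % suc K + suc K ≡⟨ cong (_+ suc K) x%N≡p ⟩
    p + suc K         ∎)
  where
  open ≡-Reasoning
  N≤x : suc K ≤ x
  N≤x = ≮⇒≥ x≮N
  u : ℕ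
  u = x ∸ suc K
  u<N : u < suc K
  u<N = +-cancelʳ-< _ _ (suc K) (subst (_< suc K + suc K) (sym (m∸n+n≡m N≤x)) x<2N)

IsInterval-cong : ∀ n (P Q : ℕ → Set) → (∀ p → p < 2 * n → P p ⇔ Q p) → IsInterval n Q → IsInterval n P
IsInterval-cong n P Q P⇔Q (s , L , s< , Q⇔) = s , L , s< , λ p p< → Q⇔ p p< ⇔-∘ P⇔Q p p<

residue-interval : ∀ m s L → s < suc m + suc m → L ≤ suc m + suc m →
  IsInterval (suc m) (λ p → Σ ℕ λ t → t < L × (s + t) % (suc m + suc m) ≡ p)
residue-interval m s L s<N L≤N =
  s , L , subst (s <_) (sym (2*n≡n+n (suc m))) s<N ,
  λ p p< → mk⇔ (to p) (from p (subst (p <_) (2*n≡n+n (suc m)) p<))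
  where
  N : ℕ
  N = suc m + suc m
  Wraps : ℕ → ℕ → Set
  Wraps p t = s + t ≡ p ⊎ s + t ≡ p + 2 * suc m
  to : ∀ p → (Σ ℕ λ t → t < L × (s + t) % N ≡ p) → Σ ℕ λ t → t < L × Wraps p t
  to p (t , t<L , eq) = t , t<L , subst (λ z → s + t ≡ p ⊎ s + t ≡ p + z) (sym (2*n≡n+n (suc m)))
    (mod-split (m + suc m) (s + t) p (+-mono-<-≤ s<N (≤-trans (<⇒≤ t<L) L≤N)) eq)
  from : ∀ p → p < N → (Σ ℕ λ t → t < L × Wraps p t) → Σ ℕ λ t → t < L × (s + t) % N ≡ p
  from p p<N (t , t<L , inj₁ eq) = t , t<L , trans (cong (_% N) eq) (m<n⇒m%n≡m p<N)
  from p p<N (t , t<L , inj₂ eq) = t , t<L ,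
    trans (cong (_% N) (trans eq (cong (p +_) (2*n≡n+n (suc m))))) (trans ([m+n]%n≡m%n p N) (m<n⇒m%n≡m p<N))

arc-residues : ∀ K Z M q → suc Z + M ≤ suc K → q < suc K →
  Arc (suc K) Z M q ⇔ (Σ ℕ λ t → t < suc Z + M × (suc K ∸ suc Z + t) % suc K ≡ q)
arc-residues K Z M q L≤N q<N = mk⇔ to from
  where
  N : ℕ
  N = suc K
  s₀ : ℕ
  s₀ = N ∸ suc Z
  Z<N : suc Z ≤ N
  Z<N = ≤-trans (m≤m+n (suc Z) M) L≤N
  s₀+Z : s₀ + suc Z ≡ N
  s₀+Z = m∸n+n≡m Z<N
  wrap : ∀ u → u < N → (s₀ + (suc Z + u)) % N ≡ u
  wrap u u<N = begin
    (s₀ + (suc Z + u)) % N ≡⟨ cong (_% N) (trans (sym (+-assoc s₀ (suc Z) u)) (cong (_+ u) s₀+Z)) ⟩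
    (N + u) % N            ≡⟨ cong (_% N) (+-comm N u) ⟩
    (u + N) % N            ≡⟨ [m+n]%n≡m%n u N ⟩
    u % N                  ≡⟨ m<n⇒m%n≡m u<N ⟩
    u                      ∎
    where open ≡-Reasoning
  to : Arc N Z M q → Σ ℕ λ t → t < suc Z + M × (s₀ + t) % N ≡ q
  to (inj₁ N≤q+Z) = q ∸ s₀ , <-≤-trans t<Z (m≤m+n (suc Z) M) ,
                    trans (cong (_% N) (m+[n∸m]≡n s₀≤q)) (m<n⇒m%n≡m q<N)
    where
    s₀≤q : s₀ ≤ q
    s₀≤q = subst (s₀ ≤_) (m+n∸n≡m q (suc Z)) (∸-monoˡ-≤ (suc Z) N≤q+Z)
    t<Z : q ∸ s₀ < suc Z
    t<Z = subst (q ∸ s₀ <_) (m∸[m∸n]≡n Z<N) (∸-monoˡ-< q<N s₀≤q)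
  to (inj₂ q<M) = suc Z + q , +-monoʳ-< (suc Z) q<M , wrap q q<N
  from : (Σ ℕ λ t → t < suc Z + M × (s₀ + t) % N ≡ q) → Arc N Z M q
  from (t , t<L , eq) with t <? suc Z
  ... | yes t<Z = inj₁ (begin
      N               ≡⟨ sym s₀+Z ⟩
      s₀ + suc Z      ≤⟨ +-monoˡ-≤ (suc Z) (m≤m+n s₀ t) ⟩
      s₀ + t + suc Z  ≡⟨ cong (_+ suc Z) (trans (sym (m<n⇒m%n≡m s₀+t<N)) eq) ⟩
      q + suc Z       ∎)
    where
    open ≤-Reasoning
    s₀+t<N : s₀ + t < N
    s₀+t<N = subst (s₀ + t <_) s₀+Z (+-monoʳ-< s₀ t<Z)
  ... | no  t≮Z = inj₂ (subst (_< M) (trans (sym (wrap u u<N)) (trans (cong (λ z → (s₀ + z) % N) Z+u) eq)) u<M)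
    where
    u : ℕ
    u = t ∸ suc Z
    Z+u : suc Z + u ≡ t
    Z+u = m+[n∸m]≡n (≮⇒≥ t≮Z)
    u<M : u < M
    u<M = +-cancelˡ-< (suc Z) u M (subst (_< suc Z + M) (sym Z+u) t<L)
    u<N : u < N
    u<N = <-≤-trans u<M (≤-trans (m≤n+m M (suc Z)) L≤N)

rotated-arc-interval : ∀ m Z M r → suc Z + M ≤ suc m + suc m →
  IsInterval (suc m) (λ p → Σ ℕ λ q → q < suc m + suc m × Arc (suc m + suc m) Z M q × (q + r) % (suc m + suc m) ≡ p)
rotated-arc-interval m Z M r L≤N =
  IsInterval-cong (suc m) _ _ rotate (residue-interval m ((s₀ + r) % N) (suc Z + M) (m%n<n (s₀ + r) N) L≤N)
  where
  N : ℕ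
  N = suc m + suc m
  s₀ : ℕ
  s₀ = N ∸ suc Z
  shift : ∀ t → ((s₀ + r) % N + t) % N ≡ ((s₀ + t) % N + r) % N
  shift t = begin
    ((s₀ + r) % N + t) % N ≡⟨ %-absorbˡ (s₀ + r) t N ⟩
    (s₀ + r + t) % N       ≡⟨ cong (_% N) (trans (+-assoc s₀ r t) (trans (cong (s₀ +_) (+-comm r t)) (sym (+-assoc s₀ t r)))) ⟩
    (s₀ + t + r) % N       ≡⟨ sym (%-absorbˡ (s₀ + t) r N) ⟩
    ((s₀ + t) % N + r) % N ∎
    where open ≡-Reasoning
  rotate : ∀ p → p < 2 * suc m →
    (Σ ℕ λ q → q < N × Arc N Z M q × (q + r) % N ≡ p) ⇔ (Σ ℕ λ t → t < suc Z + M × ((s₀ + r) % N + t) % N ≡ p)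
  rotate p _ = mk⇔ to from
    where
    to : (Σ ℕ λ q → q < N × Arc N Z M q × (q + r) % N ≡ p) → Σ ℕ λ t → t < suc Z + M × ((s₀ + r) % N + t) % N ≡ p
    to (q , q<N , arc , eq) with Equivalence.to (arc-residues (m + suc m) Z M q L≤N q<N) arc
    ... | t , t<L , s₀+t≡q = t , t<L , trans (shift t) (trans (cong (λ z → (z + r) % N) s₀+t≡q) eq)
    from : (Σ ℕ λ t → t < suc Z + M × ((s₀ + r) % N + t) % N ≡ p) → Σ ℕ λ q → q < N × Arc N Z M q × (q + r) % N ≡ p
    from (t , t<L , eq) = (s₀ + t) % N , m%n<n (s₀ + t) N ,
      Equivalence.from (arc-residues (m + suc m) Z M _ L≤N (m%n<n (s₀ + t) N)) (t , t<L , refl) ,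
      trans (sym (shift t)) eq

-- Backward direction: under the exponent conditions, π = c_m^{k_m} ρ and every tail of
-- positions of ρ fills an arc; c_m^{k_m} rotates the circle, so the tails of π are intervals.
product-is-BArc : ∀ m (π : B (suc m)) (k : ℕ → ℕ) →
  ((i : ℕ) → i < m → (k i ≡ 0 ⊎ k i ≡ 2 * i + 1)) →
  ((a : Fin (suc m)) → img π a ≡ prodC k (suc m) (false , a)) → IsBArc π
product-is-BArc m π k exponents π≡ j =
  IsInterval-cong (suc m) _ _ tail⇔ (rotated-arc-interval m (zerosAbove J) (onesAbove J) r arc≤N)
  where
  e : ℕ → Bool
  e i = not (does (k i ≟ 0))
  exps-pattern : Pattern k e m
  exps-pattern i i<m with exponents i i<m
  ... | inj₁ k≡0 rewrite k≡0 = inj₁ (refl , refl)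
  ... | inj₂ k≡1 = inj₂ (cong not (dec-false (k i ≟ 0) (subst (_≢ 0) (sym k≡1) (m+1+n≢0 (2 * i)))) , k≡1)
  open ProductPositions m k e exps-pattern
  open Positions m e
  open Filling g
  J : ℕ
  J = toℕ j
  J≤m : J ≤ m
  J≤m = s≤s⁻¹ (toℕ<n j)
  r : ℕ
  r = k m * (m + suc m)
  arc≤N : suc (zerosAbove J) + onesAbove J ≤ N
  arc≤N = ≤-trans (s≤s (≤-reflexive (trans (+-comm (zerosAbove J) _) (arc-size J))))
                  (≤-trans (s≤s (m∸n≤m m J)) (m≤m+n (suc m) (suc m)))
  g<N : ∀ a → g a < N
  g<N a = pos< m (ρ (false , a))
  pos-img : ∀ a → pos (img π a) ≡ (g a + r) % N
  pos-img a = trans (cong pos (π≡ a)) (pos-c-power m (k m) (ρ (false , a)))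
  tail⇔ : ∀ p → p < 2 * suc m →
    (Σ (Fin (suc m)) λ i → J ≤ toℕ i × pos (img π i) ≡ p) ⇔ (Σ ℕ λ q → q < N × InArc J q × (q + r) % N ≡ p)
  tail⇔ p _ = mk⇔
    (λ { (i , le , eq) → g i , g<N i , Equivalence.to (fills J J≤m (g i) (g<N i)) (i , le , refl) ,
                          trans (sym (pos-img i)) eq })
    (λ { (q , q<N , arc , eq) → let (i , le , gi) = Equivalence.from (fills J J≤m q q<N) arc in
                                 i , le , trans (pos-img i) (trans (cong (λ z → (z + r) % N) gi) eq) })

shift-moves : ∀ K y d → 0 < d → d < suc K → y < suc K → (y + d) % suc K ≢ y
shift-moves K y d 0<d d<N y<N eq with y + d <? suc K
... | yes y+d<N = <-irrefl refl (subst (y <_) (trans (sym (m<n⇒m%n≡m y+d<N)) eq) y<y+d)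
  where
  y<y+d : y < y + d
  y<y+d = subst (_< y + d) (+-identityʳ y) (+-monoʳ-< y 0<d)
... | no  y+d≮N = <-irrefl (sym (+-cancelˡ-≡ y _ _ y+N≡y+d)) d<N
  where
  N≤y+d : suc K ≤ y + d
  N≤y+d = ≮⇒≥ y+d≮N
  u : ℕ
  u = y + d ∸ suc K
  u≡y : u ≡ y
  u≡y = begin
    u                     ≡⟨ sym (m<n⇒m%n≡m (+-cancelʳ-< (suc K) u (suc K)
                                 (subst (_< suc K + suc K) (sym (m∸n+n≡m N≤y+d)) (+-mono-< y<N d<N)))) ⟩
    u % suc K             ≡⟨ sym ([m+n]%n≡m%n u (suc K)) ⟩
    (u + suc K) % suc K   ≡⟨ cong (_% suc K) (m∸n+n≡m N≤y+d) ⟩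
    (y + d) % suc K       ≡⟨ eq ⟩
    y                     ∎
    where open ≡-Reasoning
  y+N≡y+d : y + suc K ≡ y + d
  y+N≡y+d = trans (cong (_+ suc K) (sym u≡y)) (m∸n+n≡m N≤y+d)

module InInterval (m : ℕ) (P : ℕ → Set) (I : IsInterval (suc m) P) where
  N : ℕ
  N = suc m + suc m
  s : ℕ
  s = proj₁ I
  L : ℕ
  L = proj₁ (proj₂ I)
  s<N : s < N
  s<N = subst (s <_) (2*n≡n+n (suc m)) (proj₁ (proj₂ (proj₂ I)))
  P⇔ : ∀ p → p < 2 * suc m → P p ⇔ (Σ ℕ λ t → t < L × (s + t ≡ p ⊎ s + t ≡ p + 2 * suc m))
  P⇔ = proj₂ (proj₂ (proj₂ I))

  Offset : ℕ → ℕ → Set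
  Offset y t = s + t ≡ y ⊎ s + t ≡ y + N

  offset : ∀ y → y < N → P y → Σ ℕ λ t → t < L × Offset y t
  offset y y<N Py with Equivalence.to (P⇔ y (subst (y <_) (sym (2*n≡n+n (suc m))) y<N)) Py
  ... | t , t<L , inj₁ eq = t , t<L , inj₁ eq
  ... | t , t<L , inj₂ eq = t , t<L , inj₂ (trans eq (cong (y +_) (2*n≡n+n (suc m))))

  member : ∀ u → u < L → s + u < N + N → P ((s + u) % N)
  member u u<L bound = Equivalence.from (P⇔ p (subst (p <_) (sym (2*n≡n+n (suc m))) (m%n<n (s + u) N)))
    (u , u<L , map₂ (λ eq → trans eq (cong (p +_) (sym (2*n≡n+n (suc m)))))
                    (mod-split (m + suc m) (s + u) p bound refl))
    where
    p : ℕ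
    p = (s + u) % N

  offset-bound : ∀ y t → y < N → Offset y t → s + t < N + N
  offset-bound y t y<N (inj₁ eq) = subst (_< N + N) (sym eq) (<-≤-trans y<N (m≤m+n N N))
  offset-bound y t y<N (inj₂ eq) = subst (_< N + N) (sym eq) (+-monoˡ-< N y<N)

  offset-residue : ∀ y t → y < N → Offset y t → (s + t) % N ≡ y
  offset-residue y t y<N (inj₁ eq) = trans (cong (_% N) eq) (m<n⇒m%n≡m y<N)
  offset-residue y t y<N (inj₂ eq) = trans (cong (_% N) eq) (trans ([m+n]%n≡m%n y N) (m<n⇒m%n≡m y<N))

  offset-zero : ∀ y → y < N → Offset y 0 → s ≡ y
  offset-zero y y<N (inj₁ eq) = trans (sym (+-identityʳ s)) eq
  offset-zero y y<N (inj₂ eq) =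
    ⊥-elim (<-irrefl refl (<-≤-trans s<N (subst (N ≤_) (sym (trans (sym (+-identityʳ s)) eq)) (m≤n+m N y))))

  neighbour : ∀ y y' → y < N → y' < N → P y → P y' → y ≢ y' → P ((y + 1) % N) ⊎ P ((y + (m + suc m)) % N)
  neighbour y y' y<N y'<N Py Py' y≢y' with offset y y<N Py | offset y' y'<N Py'
  ... | suc u , t<L , h | _ = inj₂ (subst P before (member u (<-trans (n<1+n u) t<L) s+u<2N))
    where
    s+u<2N : s + u < N + N
    s+u<2N = <-trans (+-monoʳ-< s (n<1+n u)) (offset-bound y _ y<N h)
    before : (s + u) % N ≡ (y + (m + suc m)) % N
    before = begin
      (s + u) % N                       ≡⟨ sym ([m+n]%n≡m%n (s + u) N) ⟩
      (s + u + N) % N                   ≡⟨ cong (_% N) (trans (+-suc (s + u) (m + suc m)) (cong (_+ (m + suc m)) (sym (+-suc s u)))) ⟩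
      (s + suc u + (m + suc m)) % N     ≡⟨ sym (%-absorbˡ (s + suc u) (m + suc m) N) ⟩
      ((s + suc u) % N + (m + suc m)) % N ≡⟨ cong (λ z → (z + (m + suc m)) % N) (offset-residue y _ y<N h) ⟩
      (y + (m + suc m)) % N             ∎
      where open ≡-Reasoning
  ... | zero , _ , h | zero , _ , h' = ⊥-elim (y≢y' (trans (sym (offset-zero y y<N h)) (offset-zero y' y'<N h')))
  ... | zero , _ , h | suc u' , t'<L , _ =
    inj₁ (subst (λ z → P ((z + 1) % N)) (offset-zero y y<N h)
                (member 1 (≤-<-trans (s≤s z≤n) t'<L) (+-mono-≤ s<N (s≤s z≤n))))

arc-boundary : ∀ K Z M x → x < suc K → ¬ Arc (suc K) Z M x →
  Arc (suc K) Z M ((x + 1) % suc K) ⊎ Arc (suc K) Z M ((x + K) % suc K) → x ≡ M ⊎ x + suc (suc Z) ≡ suc K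
arc-boundary K Z M x x<N x∉ (inj₁ next) with x <? K
... | no  x≮K = ⊥-elim (x∉ (inj₁ (subst (λ z → suc z ≤ x + suc Z) (≤-antisym (s≤s⁻¹ x<N) (≮⇒≥ x≮K))
                                         (subst (suc x ≤_) (sym (+-suc x Z)) (s≤s (m≤m+n x Z))))))
... | yes x<K with subst (Arc (suc K) Z M) (succ-mod K x (s≤s x<K)) next
...   | inj₂ x+1<M = ⊥-elim (x∉ (inj₂ (<-trans (n<1+n x) x+1<M)))
...   | inj₁ N≤x+1+Z with m≤n⇒m<n∨m≡n N≤x+1+Z
...     | inj₁ N<x+1+Z = ⊥-elim (x∉ (inj₁ (s≤s⁻¹ N<x+1+Z)))
...     | inj₂ N≡x+1+Z = inj₂ (trans (+-suc x (suc Z)) (sym N≡x+1+Z))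
arc-boundary K Z M zero x<N x∉ (inj₂ prev) with 0 <? M
... | yes 0<M = ⊥-elim (x∉ (inj₂ 0<M))
... | no  0≮M = inj₁ (sym (n≤0⇒n≡0 (≮⇒≥ 0≮M)))
arc-boundary K Z M (suc w) x<N x∉ (inj₂ prev) with subst (Arc (suc K) Z M) w-back prev
  where
  w-back : (suc w + K) % suc K ≡ w
  w-back = trans (cong (_% suc K) (sym (+-suc w K)))
                 (trans ([m+n]%n≡m%n w (suc K)) (m<n⇒m%n≡m (<-trans (n<1+n w) x<N)))
... | inj₁ N≤w+Z = ⊥-elim (x∉ (inj₁ (≤-trans N≤w+Z (n≤1+n _))))
... | inj₂ w<M with m≤n⇒m<n∨m≡n w<M
...   | inj₁ x<M = ⊥-elim (x∉ (inj₂ x<M))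
...   | inj₂ x≡M = inj₁ x≡M

-- The positions of a B-arc permutation π, rotated so that π(n) sits at 2n-1.  Each
-- g(j) lies outside the arc filled by the later positions (injectivity) but next to
-- it (the tail from j is an interval), so it is placed as prescribed by the bit
-- e_j = [g(j) < n]; the exponents k_j = (2j+1)·e_j and k_m = r then reproduce π.
module ArcPositions (m : ℕ) (π : B (suc m)) (arc : IsBArc π) where
  K : ℕ
  K = m + suc m
  N : ℕ
  N = suc K

  0<K : 0 < K
  0<K = subst (0 <_) (sym (+-suc m m)) (s≤s z≤n)

  -- the positions of π and their rotation g by r, which sends π(n) to 2n-1
  y : Fin (suc m) → ℕ
  y a = pos (img π a)

  y<N : ∀ a → y a < N
  y<N a = pos< m (img π a)

  y-injective : ∀ a b → y a ≡ y b → a ≡ b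
  y-injective a b eq = absInj π (cong proj₂ (pos-injective m (img π a) (img π b) eq))

  r : ℕ
  r = K ∸ y (top m)

  g : Fin (suc m) → ℕ
  g a = (y a + r) % N

  g<N : ∀ a → g a < N
  g<N a = m%n<n (y a + r) N

  unrotate : ∀ a → (g a + r * K) % N ≡ y a
  unrotate a = begin
    ((y a + r) % N + r * K) % N ≡⟨ %-absorbˡ (y a + r) (r * K) N ⟩
    (y a + r + r * K) % N       ≡⟨ cong (_% N) (trans (+-assoc (y a) r (r * K)) (cong (y a +_) (sym (*-suc r K)))) ⟩
    (y a + r * N) % N           ≡⟨ [m+kn]%n≡m%n (y a) r N ⟩
    y a % N                     ≡⟨ m<n⇒m%n≡m (y<N a) ⟩
    y a                         ∎
    where open ≡-Reasoning

  g-injective : ∀ a b → g a ≡ g b → a ≡ b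
  g-injective a b eq = y-injective a b (trans (sym (unrotate a)) (trans (cong (λ z → (z + r * K) % N) eq) (unrotate b)))

  g-top : suc (g (top m)) ≡ N
  g-top = cong suc (trans (cong (_% N) (m+[n∸m]≡n (s≤s⁻¹ (y<N (top m))))) (m<n⇒m%n≡m (n<1+n K)))

  g-shift : ∀ a b d → y b ≡ (y a + d) % N → g b ≡ (g a + d) % N
  g-shift a b d eq = begin
    (y b + r) % N           ≡⟨ cong (λ z → (z + r) % N) eq ⟩
    ((y a + d) % N + r) % N ≡⟨ %-absorbˡ (y a + d) r N ⟩
    (y a + d + r) % N       ≡⟨ cong (_% N) (trans (+-assoc (y a) d r) (trans (cong (y a +_) (+-comm d r)) (sym (+-assoc (y a) r d)))) ⟩
    (y a + r + d) % N       ≡⟨ sym (%-absorbˡ (y a + r) d N) ⟩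
    ((y a + r) % N + d) % N ∎
    where open ≡-Reasoning

  e : ℕ → Bool
  e i with i <? suc m
  ... | yes i<n = does (g (fromℕ< i<n) <? suc m)
  ... | no  _   = false

  open Positions m e hiding (N)
  open Filling g

  e-index-true : ∀ j (lt : j < m) → g (index j lt) < suc m → e j ≡ true
  e-index-true j lt g<n with j <? suc m
  ... | yes _  = dec-true (_ <? suc m) g<n
  ... | no j≮n = ⊥-elim (j≮n (<-trans lt (n<1+n m)))

  e-index-false : ∀ j (lt : j < m) → ¬ g (index j lt) < suc m → e j ≡ false
  e-index-false j lt g≮n with j <? suc m
  ... | yes _  = dec-false (_ <? suc m) g≮n
  ... | no _   = refl

  -- g(j) is not in the arc of j+1, which g(j+1),…,g(m) fill (injectivity) …
  outside : ∀ j (lt : j < m) → FillsArc (suc j) → ¬ InArc (suc j) (g (index j lt))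
  outside j lt fills inside with Equivalence.from (fills _ (g<N _)) inside
  ... | i , le , gi = <-irrefl (sym (trans (cong toℕ (g-injective i (index j lt) gi)) (toℕ-fromℕ< _))) le

  tail-step : ∀ j (lt : j < m) → FillsArc (suc j) → ∀ d → 0 < d → d < N →
    (Σ (Fin (suc m)) λ i → toℕ (index j lt) ≤ toℕ i × y i ≡ (y (index j lt) + d) % N) →
    InArc (suc j) ((g (index j lt) + d) % N)
  tail-step j lt fills d 0<d d<N (i , le , yi) =
    Equivalence.to (fills ((g a + d) % N) (m%n<n (g a + d) N)) (i , later , g-shift a i d yi)
    where
    a : Fin (suc m)
    a = index j lt
    later : suc j ≤ toℕ i
    later = ≤∧≢⇒< (subst (_≤ toℕ i) (toℕ-fromℕ< _) le)
                  (λ j≡i → shift-moves K (y a) d 0<d d<N (y<N a)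
                             (trans (sym yi) (cong y (toℕ-injective (trans (sym j≡i) (sym (toℕ-fromℕ< _)))))))

  -- … but a circle neighbour of it is (the tail from j is an interval containing g(m) ≠ g(j))
  beside : ∀ j (lt : j < m) → FillsArc (suc j) →
    InArc (suc j) ((g (index j lt) + 1) % N) ⊎ InArc (suc j) ((g (index j lt) + K) % N)
  beside j lt fills with InInterval.neighbour m _ (arc a) (y a) (y (top m)) (y<N a) (y<N (top m))
                           (a , ≤-refl , refl) (top m , a≤top , refl) (λ eq → <-irrefl (a≡top eq) lt)
    where
    a : Fin (suc m)
    a = index j lt
    a≤top : toℕ a ≤ toℕ (top m)
    a≤top = subst₂ _≤_ (sym (toℕ-fromℕ< _)) (sym (toℕ-fromℕ< _)) (<⇒≤ lt)
    a≡top : y a ≡ y (top m) → j ≡ m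
    a≡top eq = trans (sym (toℕ-fromℕ< _)) (trans (cong toℕ (y-injective a (top m) eq)) (toℕ-fromℕ< (n<1+n m)))
  ... | inj₁ next = inj₁ (tail-step j lt fills 1 (s≤s z≤n) (s≤s 0<K) next)
  ... | inj₂ prev = inj₂ (tail-step j lt fills K 0<K ≤-refl prev)

  tail-size : ∀ j → j < m → suc (m ∸ suc j) ≤ m
  tail-size j lt = subst (_≤ m) (m∸j≡suc m j lt) (m∸n≤m m j)

  placed : ∀ j (lt : j < m) → FillsArc (suc j) → Placed (e j) (g (index j lt)) j
  placed j lt fills with arc-boundary K Z M (g a) (g<N a) (outside j lt fills) (beside j lt fills)
    where
    a : Fin (suc m)
    a = index j lt
    Z : ℕ
    Z = zerosAbove (suc j)
    M : ℕ
    M = onesAbove (suc j)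
  ... | side with g (index j lt) <? suc m | side
  ...   | yes g<n | inj₁ at-bottom = subst (λ b → Placed b _ j) (sym (e-index-true j lt g<n)) at-bottom
  ...   | no  g≮n | inj₂ at-top    = subst (λ b → Placed b _ j) (sym (e-index-false j lt g≮n)) at-top
  ...   | yes g<n | inj₂ at-top    =
    ⊥-elim (<-irrefl at-top (s≤s (+-mono-≤ (s≤s⁻¹ g<n) (s≤s (≤-trans (s≤s Z≤) (tail-size j lt))))))
    where
    Z≤ : zerosAbove (suc j) ≤ m ∸ suc j
    Z≤ = subst (zerosAbove (suc j) ≤_) (arc-size (suc j)) (m≤n+m _ _)
  ...   | no  g≮n | inj₁ at-bottom =
    ⊥-elim (g≮n (subst (_< suc m) (sym at-bottom) (s≤s (≤-trans M≤ (≤-trans (n≤1+n _) (tail-size j lt))))))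
    where
    M≤ : onesAbove (suc j) ≤ m ∸ suc j
    M≤ = subst (onesAbove (suc j) ≤_) (arc-size (suc j)) (m≤m+n _ _)

  all-fill : ∀ j → j ≤ m → FillsArc j
  all-fill = fills-all g-top placed

  k : ℕ → ℕ
  k i with i ≟ m
  ... | yes _ = r
  ... | no  _ = if e i then 2 * i + 1 else 0

  k-top : k m ≡ r
  k-top with m ≟ m
  ... | yes _  = refl
  ... | no m≢m = ⊥-elim (m≢m refl)

  k-pattern : Pattern k e m
  k-pattern i i<m with i ≟ m
  ... | yes i≡m = ⊥-elim (<-irrefl i≡m i<m)
  ... | no  _ with e i
  ...   | true  = inj₂ (refl , refl)
  ...   | false = inj₁ (refl , refl)

  module Product = ProductPositions m k e k-pattern

  -- ρ = c_{m-1}^{k_{m-1}}⋯c_0^{k_0} puts every index where g does: both are placed by the same bits.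
  product-positions : ∀ a → Product.g a ≡ g a
  product-positions a with toℕ a <? m
  ... | yes a<m = placed-unique (e (toℕ a)) (toℕ a) (Product.placed-at a a<m)
                    (subst (λ z → Placed (e (toℕ a)) (g z) (toℕ a)) (fromℕ<-toℕ a _) (placed (toℕ a) a<m (all-fill _ a<m)))
  ... | no  a≮m = suc-injective (begin
      suc (Product.g a)   ≡⟨ cong (suc ∘ Product.g) a≡top ⟩
      suc (Product.g (top m)) ≡⟨ Product.g-top ⟩
      N                   ≡⟨ sym g-top ⟩
      suc (g (top m))         ≡⟨ cong (suc ∘ g) (sym a≡top) ⟩
      suc (g a)           ∎)
    where
    open ≡-Reasoning
    a≡top : a ≡ top m
    a≡top = toℕ-injective (trans (≤-antisym (s≤s⁻¹ (toℕ<n a)) (≮⇒≥ a≮m)) (sym (toℕ-fromℕ< (n<1+n m))))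

  -- π = c_m^r ρ: compare positions, using that c_m^r undoes the rotation
  π≡product : ∀ a → img π a ≡ prodC k (suc m) (false , a)
  π≡product a = pos-injective m _ _ (begin
    y a                            ≡⟨ sym (unrotate a) ⟩
    (g a + r * K) % N              ≡⟨ cong₂ (λ u v → (u + v * K) % N) (sym (product-positions a)) (sym k-top) ⟩
    (Product.g a + k m * K) % N    ≡⟨ sym (pos-c-power m (k m) (Product.ρ (false , a))) ⟩
    pos (prodC k (suc m) (false , a)) ∎)
    where open ≡-Reasoning

  k-top-bound : k m ≤ 2 * m + 1
  k-top-bound = subst₂ _≤_ (sym k-top) (sym (2i+1≡i+suc-i m)) (m∸n≤m K (y (top m)))

  k-choices : (i : ℕ) → i < m → (k i ≡ 0 ⊎ k i ≡ 2 * i + 1)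
  k-choices i i<m = map proj₂ proj₂ (k-pattern i i<m)

proposition5p7 : (m : ℕ) → (π : B (suc m)) →
    IsBArc π ⇔
    (Σ (ℕ → ℕ) λ k →
    (k m ≤ 2 * m + 1) ×
    ((i : ℕ) → i < m → (k i ≡ 0 ⊎ k i ≡ 2 * i + 1)) ×
    ((a : Fin (suc m)) → img π a ≡ prodC k (suc m) (false , a)))
proposition5p7 m π = mk⇔
  (λ arc → let open ArcPositions m π arc in k , k-top-bound , k-choices , π≡product)
  (λ (k , _ , exponents , π≡) → product-is-BArc m π k exponents π≡)
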